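{- Let $\mathcal{G}$ be a hereditary class of graphs and let $c$ denote the maximum number of vertices of a forbidden induced subgraph for $\mathcal{G}$. Let $G$ be a forbidden induced subgraph for the edge-apex class $\mathcal{G}^{e}$ such that there are distinct subsets $S$ and $T$ of $V(G)$ for which $G[S]$ and $G[T]$ are both forbidden induced subgraphs for $\mathcal{G}$. Let $q=|S\cap T|$ and $k=|E(G[S])\cap E(G[T])|$. Then $|V(G)|\le c+(c-q)+k(c-2)$.
   Context: All graphs are finite, simple and undirected; $G[X]$ denotes the subgraph of $G$ induced on the vertex set $X$. A class of graphs is hereditary if it is closed under taking induced subgraphs. For a hereditary class $\mathcal{C}$, a forbidden induced subgraph for $\mathcal{C}$ is a graph $H$ not in $\mathcal{C}$ such that every proper induced subgraph of $H$ is in $\mathcal{C}$. The edge-apex class $\mathcal{G}^{e}$ of $\mathcal{G}$ is the class of graphs $G$ such that either $G\in\mathcal{G}$ or $G$ has an edge $e$ with $G-e\in\mathcal{G}$, where $G-e$ denotes deletion of the edge $e$ (keeping all vertices). -}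

module Defs where

open import Data.Nat using (ℕ; zero; suc; _<?_; _≤_; _+_; _*_; _∸_)
open import Data.Fin using (Fin; zero; suc; toℕ; _≟_)
open import Data.Fin.Subset using (Subset; ∣_∣; ⊤; _∩_)
open import Data.Bool using (Bool; true; false; _∧_; _∨_; not; if_then_else_)
open import Data.Bool.Properties using (∧-comm; ∨-comm)
open import Data.Vec using (Vec; []; _∷_; lookup)
open import Data.List using (List; map; allFin)
open import Data.Nat.ListAction using (sum)
open import Data.Product using (Σ; _×_; _,_)
open import Data.Sum using (_⊎_)
open import Function.Definitions using (Injective)
open import Relation.Nullary using (¬_)
open import Relation.Nullary.Decidable using (⌊_⌋)
open import Relation.Binary.PropositionalEquality using (_≡_; _≢_; refl; cong₂)

record Graph : Set where
  field
    n     : ℕ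
    adj   : Fin n → Fin n → Bool
    sym   : ∀ i j → adj i j ≡ adj j i
    irrefl : ∀ i → adj i i ≡ false
open Graph public

elems : ∀ {m} (X : Subset m) → Fin ∣ X ∣ → Fin m
elems {zero} [] ()
elems (true ∷ X) zero = zero
elems (true ∷ X) (suc i) = suc (elems X i)
elems (false ∷ X) i = suc (elems X i)

_[_] : (G : Graph) → Subset (n G) → Graph
G [ X ] = record
  { n = ∣ X ∣
  ; adj = λ i j → adj G (elems X i) (elems X j)
  ; sym = λ i j → sym G (elems X i) (elems X j)
  ; irrefl = λ i → irrefl G (elems X i)
  }

_≼_ : Graph → Graph → Set
H ≼ G = Σ (Fin (n H) → Fin (n G)) λ f →
          Injective _≡_ _≡_ f × (∀ i j → adj H i j ≡ adj G (f i) (f j))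

Class : Set₁
Class = Graph → Set

Hereditary : Class → Set
Hereditary C = ∀ G H → H ≼ G → C G → C H

Forbidden : Class → Graph → Set
Forbidden C H = ¬ C H × (∀ (X : Subset (n H)) → X ≢ ⊤ → C (H [ X ]))

private
  isPair : ∀ {m} → Fin m → Fin m → Fin m → Fin m → Bool
  isPair u v i j = (⌊ i ≟ u ⌋ ∧ ⌊ j ≟ v ⌋) ∨ (⌊ i ≟ v ⌋ ∧ ⌊ j ≟ u ⌋)

  isPair-sym : ∀ {m} (u v i j : Fin m) → isPair u v i j ≡ isPair u v j i
  isPair-sym u v i j
    rewrite ∧-comm ⌊ i ≟ u ⌋ ⌊ j ≟ v ⌋ | ∧-comm ⌊ i ≟ v ⌋ ⌊ j ≟ u ⌋
    = ∨-comm (⌊ j ≟ v ⌋ ∧ ⌊ i ≟ u ⌋) (⌊ j ≟ u ⌋ ∧ ⌊ i ≟ v ⌋)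

deleteEdge : (G : Graph) → Fin (n G) → Fin (n G) → Graph
deleteEdge G u v = record
  { n = n G
  ; adj = λ i j → adj G i j ∧ not (isPair u v i j)
  ; sym = λ i j → cong₂ (λ a b → a ∧ not b) (sym G i j) (isPair-sym u v i j)
  ; irrefl = λ i → cong₂ _∧_ (irrefl G i) refl
  }

EdgeApex : Class → Class
EdgeApex C G = C G ⊎ Σ (Fin (n G)) λ u → Σ (Fin (n G)) λ v →
                 adj G u v ≡ true × C (deleteEdge G u v)

-- |E(G[S]) ∩ E(G[T])|: the number of edges ij (i < j) of G with both
-- ends in S and both ends in T.
commonEdges : (G : Graph) → Subset (n G) → Subset (n G) → ℕ
commonEdges G S T =
  sum (map (λ i → sum (map (λ j →
    if ⌊ toℕ i <? toℕ j ⌋ ∧ adj G i j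
         ∧ (lookup S i ∧ lookup S j) ∧ (lookup T i ∧ lookup T j)
    then 1 else 0) (allFin (n G)))) (allFin (n G)))

IsMaxForbiddenSize : Class → ℕ → Set
IsMaxForbiddenSize C c =
  (∀ H → Forbidden C H → n H ≤ c) × Σ Graph (λ H → Forbidden C H × n H ≡ c)

-- For every edge e = uv common to G[S] and G[T], minimality of G for the edge-apex class gives
-- G − e ∉ C, hence a forbidden induced subgraph F_e of G − e, with at most c vertices. F_e meets
-- B = S ∪ T in at least two vertices: otherwise F_e is also induced in G, and minimality of G forces
-- S ∪ V(F_e) = T ∪ V(F_e) = V(G), so that one of S, T strictly contains the other, which is
-- impossible for two forbidden subgraphs. Hence X = B ∪ ⋃ₑ V(F_e) has at most
-- |B| + k(c − 2) ≤ 2c − q + k(c − 2) vertices. Finally X = V(G): otherwise G[X] lies in the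
-- edge-apex class, but G[X] ∉ C (it contains G[S]) and G[X] − uv ∉ C for each edge uv, since it
-- contains G[S], G[T] or F_uv. As C need not be decidable, the F_e exist only classically; this
-- suffices because the conclusion is a decidable inequality.
module Submission where

open import Defs hiding (sym)
open import Data.Bool using (Bool; true; false; _∧_; _∨_; not; if_then_else_)
open import Data.Bool.Properties using (∧-identityʳ; ∨-comm; ∧-conicalˡ; ∧-conicalʳ)
import Data.Bool.Properties as Bool
open import Data.Empty using (⊥-elim)
open import Data.Fin using (Fin; zero; suc; toℕ; _≟_)
open import Data.Fin.Properties using (suc-injective; ¬∀⟶∃¬; ∀-cons; <-cmp)
open import Data.Fin.Subset
  using (Subset; ∣_∣; _∩_; _∪_; _⊆_; _⊂_; _∈_; _∉_; ⊤; ⁅_⁆; ∁; ⋃) renaming (⊥ to ∅)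
open import Data.Fin.Subset.Properties
open import Data.List using ([]; _∷_; map; allFin)
open import Data.List.Membership.Propositional using () renaming (_∈_ to _∈ₗ_)
open import Data.List.Membership.Propositional.Properties using (∈-allFin)
open import Data.List.Relation.Unary.Any using () renaming (here to hereₗ; there to thereₗ)
open import Data.Nat using (ℕ; zero; suc; _≤_; _<_; _+_; _*_; _∸_; z≤n; s≤s; _<?_; _≤?_)
open import Data.Nat.ListAction using (sum)
open import Data.Nat.Properties
  using (≤-refl; ≤-reflexive; ≤-trans; ≤-<-trans; <-≤-trans; ≰⇒>; <⇒≱; m≤m+n; +-suc; +-assoc;
         +-monoʳ-≤; +-monoˡ-≤; +-mono-≤; *-identityˡ; *-distribʳ-+; +-∸-assoc; m+n≤o⇒m≤o∸n;
         module ≤-Reasoning)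
open import Data.Product using (Σ; ∃; _×_; _,_; proj₁; proj₂; swap)
open import Data.Sum using (_⊎_; inj₁; inj₂)
open import Data.Vec using (_∷_; []; here; there; lookup)
open import Data.Vec.Properties using (≡-dec; []=⇒lookup; lookup⇒[]=)
open import Function using (_∘_; id)
open import Function.Definitions using (Injective)
open import Relation.Binary.Definitions using (tri<; tri≈; tri>)
open import Relation.Binary.PropositionalEquality
  using (_≡_; _≢_; refl; sym; trans; cong; cong₂; subst)
open import Relation.Nullary using (¬_; yes; no; contradiction)
open import Relation.Nullary.Decidable using (⌊_⌋; decidable-stable; _×-dec_; _→-dec_)
open import Relation.Nullary.Negation using (¬¬-map)

private
  variable
    m k : ℕ
    p q r : Subset m
    x y : Fin m

¬¬-∀-Fin : ∀ {P : Fin m → Set} → (∀ i → ¬ ¬ P i) → ¬ ¬ (∀ i → P i)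
¬¬-∀-Fin {zero} _ ¬∀ = ¬∀ λ ()
¬¬-∀-Fin {suc m} ¬¬P ¬∀ = ¬¬P zero λ P₀ → ¬¬-∀-Fin (¬¬P ∘ suc) λ Pₛ → ¬∀ (∀-cons P₀ Pₛ)

-- Subsets of Fin m

∣p∪q∣+∣p∩q∣≡∣p∣+∣q∣ : ∀ (p q : Subset m) → ∣ p ∪ q ∣ + ∣ p ∩ q ∣ ≡ ∣ p ∣ + ∣ q ∣
∣p∪q∣+∣p∩q∣≡∣p∣+∣q∣ [] [] = refl
∣p∪q∣+∣p∩q∣≡∣p∣+∣q∣ (true ∷ p) (true ∷ q) =
  cong suc (trans (+-suc _ _) (trans (cong suc (∣p∪q∣+∣p∩q∣≡∣p∣+∣q∣ p q)) (sym (+-suc _ _))))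
∣p∪q∣+∣p∩q∣≡∣p∣+∣q∣ (true ∷ p) (false ∷ q) = cong suc (∣p∪q∣+∣p∩q∣≡∣p∣+∣q∣ p q)
∣p∪q∣+∣p∩q∣≡∣p∣+∣q∣ (false ∷ p) (true ∷ q) =
  trans (cong suc (∣p∪q∣+∣p∩q∣≡∣p∣+∣q∣ p q)) (sym (+-suc _ _))
∣p∪q∣+∣p∩q∣≡∣p∣+∣q∣ (false ∷ p) (false ∷ q) = ∣p∪q∣+∣p∩q∣≡∣p∣+∣q∣ p q

∣p∪q∣≤∣p∣+∣q∣ : ∀ (p q : Subset m) → ∣ p ∪ q ∣ ≤ ∣ p ∣ + ∣ q ∣
∣p∪q∣≤∣p∣+∣q∣ p q = subst (∣ p ∪ q ∣ ≤_) (∣p∪q∣+∣p∩q∣≡∣p∣+∣q∣ p q) (m≤m+n _ _)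

∣p∪q∣≤c+[c∸∣p∩q∣] : ∀ {c} (p q : Subset m) → ∣ p ∣ ≤ c → ∣ q ∣ ≤ c → ∣ p ∪ q ∣ ≤ c + (c ∸ ∣ p ∩ q ∣)
∣p∪q∣≤c+[c∸∣p∩q∣] {c = c} p q ∣p∣≤c ∣q∣≤c = begin
  ∣ p ∪ q ∣             ≤⟨ m+n≤o⇒m≤o∸n _ ∣p∪q∣+∣p∩q∣≤c+c ⟩
  (c + c) ∸ ∣ p ∩ q ∣   ≡⟨ +-∸-assoc c (≤-trans (∣p∩q∣≤∣p∣ p q) ∣p∣≤c) ⟩
  c + (c ∸ ∣ p ∩ q ∣)   ∎
  where
  open ≤-Reasoning
  ∣p∪q∣+∣p∩q∣≤c+c = subst (_≤ c + c) (sym (∣p∪q∣+∣p∩q∣≡∣p∣+∣q∣ p q)) (+-mono-≤ ∣p∣≤c ∣q∣≤c)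

∩-monoˡ-⊆ : p ⊆ q → p ∩ r ⊆ q ∩ r
∩-monoˡ-⊆ {p = p} {r = r} p⊆q x∈p∩r with x∈p∩q⁻ p r x∈p∩r
... | x∈p , x∈r = x∈p∩q⁺ (p⊆q x∈p , x∈r)

∣p∣<2⇒x≡y : ∣ p ∣ < 2 → x ∈ p → y ∈ p → x ≡ y
∣p∣<2⇒x≡y {x = x} {y = y} ∣p∣<2 x∈p y∈p with x ≟ y
... | yes x≡y = x≡y
... | no x≢y = contradiction (≤-trans (s≤s (nonempty y∈p-x)) (x∈p⇒∣p-x∣<∣p∣ x∈p)) (<⇒≱ ∣p∣<2)
  where
  y∈p-x = x∈p∧x≢y⇒x∈p-y y∈p (x≢y ∘ sym)
  nonempty : ∀ {z} {s : Subset _} → z ∈ s → 1 ≤ ∣ s ∣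
  nonempty z∈s = ≤-trans (s≤s z≤n) (x∈p⇒∣p-x∣<∣p∣ z∈s)

∣p∩q∣<2⇒¬[x,y∈q] : ∣ p ∩ q ∣ < 2 → x ∈ p → y ∈ p → x ≢ y → ¬ (x ∈ q × y ∈ q)
∣p∩q∣<2⇒¬[x,y∈q] small x∈p y∈p x≢y (x∈q , y∈q) =
  x≢y (∣p∣<2⇒x≡y small (x∈p∩q⁺ (x∈p , x∈q)) (x∈p∩q⁺ (y∈p , y∈q)))

p∪q≡⊤∧x∉p⇒x∈q : p ∪ q ≡ ⊤ → x ∉ p → x ∈ q
p∪q≡⊤∧x∉p⇒x∈q {p = p} {q = q} {x = x} p∪q≡⊤ x∉p with x∈p∪q⁻ p q (subst (x ∈_) (sym p∪q≡⊤) ∈⊤)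
... | inj₁ x∈p = contradiction x∈p x∉p
... | inj₂ x∈q = x∈q

⊈⇒∃∈∉ : ¬ p ⊆ q → ∃ λ x → x ∈ p × x ∉ q
⊈⇒∃∈∉ {m} {p} {q} p⊈q with ¬∀⟶∃¬ m (λ x → x ∈ p → x ∈ q) (λ x → x ∈? p →-dec x ∈? q) (λ p⊆q → p⊈q (p⊆q _))
... | x , x∈p↛x∈q =
  x , decidable-stable (x ∈? p) (λ x∉p → x∈p↛x∈q (λ x∈p → contradiction x∈p x∉p)) , x∈p↛x∈q ∘ λ x∈q _ → x∈q

≢⇒∃∈∉ : p ≢ q → (∃ λ x → x ∈ p × x ∉ q) ⊎ (∃ λ x → x ∈ q × x ∉ p)
≢⇒∃∈∉ {p = p} {q = q} p≢q with p ⊆? q | q ⊆? p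
... | no p⊈q | _ = inj₁ (⊈⇒∃∈∉ p⊈q)
... | yes _ | no q⊈p = inj₂ (⊈⇒∃∈∉ q⊈p)
... | yes p⊆q | yes q⊆p = contradiction (⊆-antisym p⊆q q⊆p) p≢q

≢⊤⇒∃∉ : p ≢ ⊤ → ∃ λ x → x ∉ p
≢⊤⇒∃∉ p≢⊤ with ⊈⇒∃∈∉ (λ ⊤⊆p → p≢⊤ (⊆-antisym ⊆⊤ ⊤⊆p))
... | x , _ , x∉p = x , x∉p

x∉p⇒∣p∣<n : ∀ {x : Fin m} {p : Subset m} → x ∉ p → ∣ p ∣ < m
x∉p⇒∣p∣<n {x = x} {p} x∉p = subst (∣ p ∣ <_) (∣⊤∣≡n _) (p⊂q⇒∣p∣<∣q∣ (⊆⊤ , x , ∈⊤ , x∉p))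

covers⇒⊂ : p ∪ r ≡ ⊤ → q ∪ r ≡ ⊤ → ∣ (p ∪ q) ∩ r ∣ < 2 → x ∈ p → x ∉ q → q ⊂ p
covers⇒⊂ {p = p} {r = r} {q = q} {x = w} p∪r≡⊤ q∪r≡⊤ small w∈p w∉q = q⊆p , w , w∈p , w∉q
  where
  q⊆p : q ⊆ p
  q⊆p {x} x∈q with x ∈? p
  ... | yes x∈p = x∈p
  ... | no x∉p = contradiction (subst (_∈ q) x≡w x∈q) w∉q
    where
    x≡w = ∣p∣<2⇒x≡y small (x∈p∩q⁺ (q⊆p∪q p q x∈q , p∪q≡⊤∧x∉p⇒x∈q p∪r≡⊤ x∉p))
                           (x∈p∩q⁺ (p⊆p∪q q w∈p , p∪q≡⊤∧x∉p⇒x∈q q∪r≡⊤ w∉q))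

image : (Fin k → Fin m) → Subset m
image {zero} f = ∅
image {suc k} f = ⁅ f zero ⁆ ∪ image (f ∘ suc)

∈-image : (f : Fin k → Fin m) (i : Fin k) → f i ∈ image f
∈-image f zero = x∈p∪q⁺ (inj₁ (x∈⁅x⁆ (f zero)))
∈-image f (suc i) = x∈p∪q⁺ (inj₂ (∈-image (f ∘ suc) i))

∣image∣≤ : (f : Fin k → Fin m) → ∣ image f ∣ ≤ k
∣image∣≤ {zero} {m} f = ≤-reflexive (∣⊥∣≡0 m)
∣image∣≤ {suc k} f = begin
  ∣ ⁅ f zero ⁆ ∪ image (f ∘ suc) ∣      ≤⟨ ∣p∪q∣≤∣p∣+∣q∣ ⁅ f zero ⁆ _ ⟩
  ∣ ⁅ f zero ⁆ ∣ + ∣ image (f ∘ suc) ∣  ≡⟨ cong (_+ ∣ image (f ∘ suc) ∣) (∣⁅x⁆∣≡1 (f zero)) ⟩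
  suc ∣ image (f ∘ suc) ∣               ≤⟨ s≤s (∣image∣≤ (f ∘ suc)) ⟩
  suc k                                 ∎
  where open ≤-Reasoning

⊆-⋃ : ∀ {I : Set} (Y : I → Subset m) {i is} → i ∈ₗ is → Y i ⊆ ⋃ (map Y is)
⊆-⋃ Y (hereₗ refl) = p⊆p∪q _
⊆-⋃ Y {is = j ∷ _} (thereₗ i∈is) = q⊆p∪q (Y j) _ ∘ ⊆-⋃ Y i∈is

AddsAtMost : ℕ → Subset m → Subset m → ℕ → Set
AddsAtMost d A Y k = ∀ A′ → A ⊆ A′ → ∣ A′ ∪ Y ∣ ≤ ∣ A′ ∣ + k * d

∅-adds : ∀ {d} (A : Subset m) → AddsAtMost d A ∅ 0
∅-adds A A′ _ = ≤-trans (≤-reflexive (cong ∣_∣ (∪-identityʳ A′))) (m≤m+n _ _)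

overlap-adds : ∀ {c} (A Y : Subset m) → ∣ Y ∣ ≤ c → 2 ≤ ∣ A ∩ Y ∣ → AddsAtMost (c ∸ 2) A Y 1
overlap-adds {c = c} A Y ∣Y∣≤c 2≤∣A∩Y∣ A′ A⊆A′ = begin
  ∣ A′ ∪ Y ∣              ≤⟨ m+n≤o⇒m≤o∸n _ ∣A′∪Y∣+2≤∣A′∣+c ⟩
  (∣ A′ ∣ + c) ∸ 2        ≡⟨ +-∸-assoc ∣ A′ ∣ (≤-trans 2≤∣A∩Y∣ (≤-trans (∣p∩q∣≤∣q∣ A Y) ∣Y∣≤c)) ⟩
  ∣ A′ ∣ + (c ∸ 2)        ≡⟨ cong (∣ A′ ∣ +_) (sym (*-identityˡ (c ∸ 2))) ⟩
  ∣ A′ ∣ + 1 * (c ∸ 2)    ∎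
  where
  open ≤-Reasoning
  ∣A′∪Y∣+2≤∣A′∣+c : ∣ A′ ∪ Y ∣ + 2 ≤ ∣ A′ ∣ + c
  ∣A′∪Y∣+2≤∣A′∣+c = begin
    ∣ A′ ∪ Y ∣ + 2             ≤⟨ +-monoʳ-≤ ∣ A′ ∪ Y ∣ (≤-trans 2≤∣A∩Y∣ (p⊆q⇒∣p∣≤∣q∣ (∩-monoˡ-⊆ A⊆A′))) ⟩
    ∣ A′ ∪ Y ∣ + ∣ A′ ∩ Y ∣    ≡⟨ ∣p∪q∣+∣p∩q∣≡∣p∣+∣q∣ A′ Y ⟩
    ∣ A′ ∣ + ∣ Y ∣             ≤⟨ +-monoʳ-≤ ∣ A′ ∣ ∣Y∣≤c ⟩
    ∣ A′ ∣ + c                 ∎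

⋃-adds : ∀ {I : Set} {d} {A : Subset m} {Y : I → Subset m} {w : I → ℕ} →
         (∀ i → AddsAtMost d A (Y i) (w i)) → ∀ is → AddsAtMost d A (⋃ (map Y is)) (sum (map w is))
⋃-adds {d = d} {A} adds [] = ∅-adds {d = d} A
⋃-adds {d = d} {A} {Y} {w} adds (i ∷ is) A′ A⊆A′ = begin
  ∣ A′ ∪ (Y i ∪ ⋃ (map Y is)) ∣                ≡⟨ cong ∣_∣ (sym (∪-assoc A′ (Y i) _)) ⟩
  ∣ (A′ ∪ Y i) ∪ ⋃ (map Y is) ∣                ≤⟨ ⋃-adds adds is (A′ ∪ Y i) (⊆-trans A⊆A′ (p⊆p∪q (Y i))) ⟩
  ∣ A′ ∪ Y i ∣ + rest                          ≤⟨ +-monoˡ-≤ rest (adds i A′ A⊆A′) ⟩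
  ∣ A′ ∣ + w i * d + rest                      ≡⟨ +-assoc ∣ A′ ∣ (w i * d) rest ⟩
  ∣ A′ ∣ + (w i * d + rest)                    ≡⟨ cong (∣ A′ ∣ +_) (sym (*-distribʳ-+ d (w i) _)) ⟩
  ∣ A′ ∣ + (w i + sum (map w is)) * d          ∎
  where
  open ≤-Reasoning
  rest = sum (map w is) * d

-- Induced subgraphs, embeddings and edge deletion

elems-∈ : (X : Subset m) (i : Fin ∣ X ∣) → elems X i ∈ X
elems-∈ (true ∷ X) zero = here
elems-∈ (true ∷ X) (suc i) = there (elems-∈ X i)
elems-∈ (false ∷ X) i = there (elems-∈ X i)

elems-injective : (X : Subset m) → Injective _≡_ _≡_ (elems X)
elems-injective (true ∷ X) {zero} {zero} _ = refl
elems-injective (true ∷ X) {suc i} {suc j} e = cong suc (elems-injective X (suc-injective e))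
elems-injective (false ∷ X) e = elems-injective X (suc-injective e)

elems⁻¹ : {X : Subset m} → x ∈ X → Fin ∣ X ∣
elems⁻¹ {X = true ∷ X} here = zero
elems⁻¹ {X = true ∷ X} (there x∈X) = suc (elems⁻¹ x∈X)
elems⁻¹ {X = false ∷ X} (there x∈X) = elems⁻¹ x∈X

elems-elems⁻¹ : {X : Subset m} (x∈X : x ∈ X) → elems X (elems⁻¹ x∈X) ≡ x
elems-elems⁻¹ {X = true ∷ X} here = refl
elems-elems⁻¹ {X = true ∷ X} (there x∈X) = cong suc (elems-elems⁻¹ x∈X)
elems-elems⁻¹ {X = false ∷ X} (there x∈X) = cong suc (elems-elems⁻¹ x∈X)

adj⇒≢ : ∀ G {u v} → adj G u v ≡ true → u ≢ v
adj⇒≢ G uv refl with () ← trans (sym (irrefl G _)) uv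

-- _≼_ as a record, so that both graphs can be inferred from an embedding.
record Embedding (F G : Graph) : Set where
  field
    to            : Fin (n F) → Fin (n G)
    injective     : Injective _≡_ _≡_ to
    adj-preserved : ∀ i j → adj F i j ≡ adj G (to i) (to j)

open Embedding

private
  variable
    F G H : Graph

Embedding⇒≼ : Embedding F G → F ≼ G
Embedding⇒≼ f = to f , injective f , adj-preserved f

Embedding-refl : Embedding G G
Embedding-refl = record { to = id ; injective = id ; adj-preserved = λ _ _ → refl }

Embedding-trans : Embedding F H → Embedding H G → Embedding F G
Embedding-trans f g = record
  { to            = to g ∘ to f
  ; injective     = injective f ∘ injective g
  ; adj-preserved = λ i j → trans (adj-preserved f i j) (adj-preserved g (to f i) (to f j))
  }

induced : ∀ G X → Embedding (G [ X ]) G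
induced G X = record { to = elems X ; injective = elems-injective X ; adj-preserved = λ _ _ → refl }

restrict : ∀ {X} (f : Embedding F G) → (∀ k → to f k ∈ X) → Embedding F (G [ X ])
restrict {G = G} {X} f f∈X = record
  { to            = elems⁻¹ ∘ f∈X
  ; injective     = λ e → injective f (trans (sym (elems-to _)) (trans (cong (elems X) e) (elems-to _)))
  ; adj-preserved = λ i j → trans (adj-preserved f i j) (sym (cong₂ (adj G) (elems-to i) (elems-to j)))
  }
  where
  elems-to : ∀ k → elems X (elems⁻¹ (f∈X k)) ≡ to f k
  elems-to k = elems-elems⁻¹ (f∈X k)

induced-⊆ : ∀ G {Y X} → Y ⊆ X → Embedding (G [ Y ]) (G [ X ])
induced-⊆ G {Y} Y⊆X = restrict (induced G Y) (Y⊆X ∘ elems-∈ Y)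

restrict-avoiding : (f : Embedding F G) → ∀ {v} → (∀ k → to f k ≢ v) → Embedding F (G [ ∁ ⁅ v ⁆ ])
restrict-avoiding f f≢v = restrict f (λ k → x∉p⇒x∈∁p (x≢y⇒x∉⁅y⁆ (f≢v k)))

⌊≟⌋-injective : {f : Fin k → Fin m} → Injective _≡_ _≡_ f → ∀ i j → ⌊ f i ≟ f j ⌋ ≡ ⌊ i ≟ j ⌋
⌊≟⌋-injective {f = f} f-inj i j with i ≟ j | f i ≟ f j
... | yes refl | yes _ = refl
... | yes refl | no fi≢fi = contradiction refl fi≢fi
... | no i≢j | yes fi≡fj = contradiction (f-inj fi≡fj) i≢j
... | no _ | no _ = refl

⌊≟⌋∧⌊≟⌋≡false : ∀ {i j u v : Fin m} → ¬ (i ≡ u × j ≡ v) → (⌊ i ≟ u ⌋ ∧ ⌊ j ≟ v ⌋) ≡ false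
⌊≟⌋∧⌊≟⌋≡false {i = i} {j} {u} {v} ¬[i≡u×j≡v] with i ≟ u | j ≟ v
... | yes i≡u | yes j≡v = contradiction (i≡u , j≡v) ¬[i≡u×j≡v]
... | yes _ | no _ = refl
... | no _ | _ = refl

deleteEdge-adj : ∀ G {W u v i j} → ¬ (u ∈ W × v ∈ W) → i ∈ W → j ∈ W →
                 adj (deleteEdge G u v) i j ≡ adj G i j
deleteEdge-adj G {W} {u} {v} {i} {j} ¬[u,v∈W] i∈W j∈W =
  trans (cong (λ b → adj G i j ∧ not b) (cong₂ _∨_ (⌊≟⌋∧⌊≟⌋≡false (off i∈W j∈W))
                                                    (⌊≟⌋∧⌊≟⌋≡false (off j∈W i∈W ∘ swap))))
        (∧-identityʳ _)
  where
  off : ∀ {x y} → x ∈ W → y ∈ W → ¬ (x ≡ u × y ≡ v)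
  off x∈W y∈W (refl , refl) = ¬[u,v∈W] (x∈W , y∈W)

module _ {F G : Graph} {u v : Fin (n G)} {W : Subset (n G)} where

  to-deleteEdge : (f : Embedding F G) → (∀ k → to f k ∈ W) → ¬ (u ∈ W × v ∈ W) →
                  Embedding F (deleteEdge G u v)
  to-deleteEdge f f∈W ¬[u,v∈W] = record
    { to            = to f
    ; injective     = injective f
    ; adj-preserved = λ k l → trans (adj-preserved f k l) (sym (deleteEdge-adj G ¬[u,v∈W] (f∈W k) (f∈W l)))
    }

  from-deleteEdge : (f : Embedding F (deleteEdge G u v)) → (∀ k → to f k ∈ W) → ¬ (u ∈ W × v ∈ W) →
                    Embedding F G
  from-deleteEdge f f∈W ¬[u,v∈W] = record
    { to            = to f
    ; injective     = injective f
    ; adj-preserved = λ k l → trans (adj-preserved f k l) (deleteEdge-adj G ¬[u,v∈W] (f∈W k) (f∈W l))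
    }

deleteEdge-comm : ∀ {u v} → Embedding F (deleteEdge G u v) → Embedding F (deleteEdge G v u)
deleteEdge-comm {G = G} {u} {v} f = record
  { to            = to f
  ; injective     = injective f
  ; adj-preserved = λ k l → trans (adj-preserved f k l)
                      (cong (λ b → adj G (to f k) (to f l) ∧ not b)
                            (∨-comm (⌊ to f k ≟ u ⌋ ∧ ⌊ to f l ≟ v ⌋) _))
  }

deleteEdge-[] : ∀ G X (u v : Fin ∣ X ∣) →
                Embedding (deleteEdge G (elems X u) (elems X v) [ X ]) (deleteEdge (G [ X ]) u v)
deleteEdge-[] G X u v = record
  { to            = id
  ; injective     = id
  ; adj-preserved = λ i j → cong (λ b → adj G (elems X i) (elems X j) ∧ not b)
                      (cong₂ _∨_ (cong₂ _∧_ (≟X i u) (≟X j v)) (cong₂ _∧_ (≟X i v) (≟X j u)))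
  }
  where ≟X = ⌊≟⌋-injective (elems-injective X)

-- Forbidden induced subgraphs of a hereditary class

module _ {C : Class} (hered : Hereditary C) where

  hereditary : Embedding F G → C G → C F
  hereditary {F} {G} f = hered G F (Embedding⇒≼ f)

  forbidden-avoiding : Forbidden C G → (f : Embedding F G) → ∀ {v} → (∀ k → to f k ≢ v) → C F
  forbidden-avoiding G-forbidden f {v} f≢v =
    hereditary (restrict-avoiding f f≢v) (proj₂ G-forbidden (∁ ⁅ v ⁆) ∁⁅v⁆≢⊤)
    where
    ∁⁅v⁆≢⊤ : ∁ ⁅ v ⁆ ≢ ⊤
    ∁⁅v⁆≢⊤ e = x∈∁p⇒x∉p (subst (v ∈_) (sym e) ∈⊤) (x∈⁅x⁆ v)

  forbidden-⊂ : ∀ {S T : Subset (n G)} → Forbidden C (G [ S ]) → T ⊂ S → C (G [ T ])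
  forbidden-⊂ {G} {S} {T} S-forbidden (T⊆S , w , w∈S , w∉T) =
    forbidden-avoiding S-forbidden (induced-⊆ G T⊆S) misses-w
    where
    misses-w : ∀ k → elems⁻¹ (T⊆S (elems-∈ T k)) ≢ elems⁻¹ w∈S
    misses-w k e = w∉T (subst (_∈ T) elems-T-k≡w (elems-∈ T k))
      where
      elems-T-k≡w = trans (sym (elems-elems⁻¹ _)) (trans (cong (elems S) e) (elems-elems⁻¹ w∈S))

  vertex-deleted∈C⇒forbidden : ¬ C G → (∀ v → C (G [ ∁ ⁅ v ⁆ ])) → Forbidden C G
  vertex-deleted∈C⇒forbidden {G} ¬CG G-v∈C = ¬CG , λ X X≢⊤ → let (v , v∉X) = ≢⊤⇒∃∉ X≢⊤ in
    hereditary (restrict-avoiding (induced G X) (λ k e → v∉X (subst (_∈ X) e (elems-∈ X k)))) (G-v∈C v)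

  -- Only up to ¬ ¬, as C need not be decidable.
  forbidden-embedding : ∀ G → ¬ C G → ¬ ¬ (Σ Graph λ F → Forbidden C F × Embedding F G)
  forbidden-embedding G = go (suc (n G)) G ≤-refl
    where
    go : ∀ s G → n G < s → ¬ C G → ¬ ¬ (Σ Graph λ F → Forbidden C F × Embedding F G)
    go (suc s) G (s≤s size) ¬CG ¬found =
      ¬¬-∀-Fin G-v∈C (λ all → ¬found (G , vertex-deleted∈C⇒forbidden ¬CG all , Embedding-refl))
      where
      G-v∈C : ∀ v → ¬ ¬ C (G [ ∁ ⁅ v ⁆ ])
      G-v∈C v ¬C[G-v] = go s (G [ ∁ ⁅ v ⁆ ]) (<-≤-trans (x∉p⇒∣p∣<n (x∈p⇒x∉∁p (x∈⁅x⁆ v))) size) ¬C[G-v]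
        λ (F , F-forbidden , f) → ¬found (F , F-forbidden , Embedding-trans f (induced G _))

-- Forbidden induced subgraphs of the edge-apex class

module EdgeApexForbidden {C : Class} (hered : Hereditary C) {G : Graph} (G-forbidden : Forbidden (EdgeApex C) G)
  where

  -- A witness that G[W] − uv ∉ C, as (G − uv)[W] contains F.
  Blocked : Subset (n G) → Fin (n G) → Fin (n G) → Set
  Blocked W u v = Σ Graph λ F → ¬ C F × Σ (Embedding F (deleteEdge G u v)) λ f → ∀ k → to f k ∈ W

  Blocked-⊆ : ∀ {W W′ u v} → W ⊆ W′ → Blocked W u v → Blocked W′ u v
  Blocked-⊆ W⊆W′ (F , ¬CF , f , f∈W) = F , ¬CF , f , W⊆W′ ∘ f∈W

  Blocked-comm : ∀ {W u v} → Blocked W u v → Blocked W v u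
  Blocked-comm (F , ¬CF , f , f∈W) = F , ¬CF , deleteEdge-comm f , f∈W

  induced-blocks : ∀ {Z W u v} → ¬ C (G [ Z ]) → Z ⊆ W → ¬ (u ∈ Z × v ∈ Z) → Blocked W u v
  induced-blocks {Z} ¬C[Z] Z⊆W ¬[u,v∈Z] =
    G [ Z ] , ¬C[Z] , to-deleteEdge (induced G Z) (elems-∈ Z) ¬[u,v∈Z] , Z⊆W ∘ elems-∈ Z

  -- By minimality of G, a proper G[W] would be in C or become so after deleting one of its edges.
  spanning : ∀ W → ¬ C (G [ W ]) → (∀ {u v} → adj G u v ≡ true → Blocked W u v) → W ≡ ⊤
  spanning W ¬C[W] blocked with ≡-dec Bool._≟_ W ⊤
  ... | yes W≡⊤ = W≡⊤
  ... | no W≢⊤ with proj₂ G-forbidden W W≢⊤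
  ...   | inj₁ C[W] = contradiction C[W] ¬C[W]
  ...   | inj₂ (u , v , uv , C[W-uv]) with blocked uv
  ...     | F , ¬CF , f , f∈W =
    contradiction (hereditary hered (Embedding-trans (restrict f f∈W) (deleteEdge-[] G W u v)) C[W-uv]) ¬CF

  cover : ∀ {Z F} → ¬ C (G [ Z ]) → ¬ C F → (g : Embedding F G) →
          ∣ Z ∩ image (to g) ∣ < 2 → Z ∪ image (to g) ≡ ⊤
  cover {Z} {F} ¬C[Z] ¬CF g ∣Z∩I∣<2 =
    spanning (Z ∪ I) (¬C[Z] ∘ hereditary hered (induced-⊆ G (p⊆p∪q I))) blocked
    where
    I = image (to g)
    blocked : ∀ {u v} → adj G u v ≡ true → Blocked (Z ∪ I) u v
    blocked {u} {v} uv with u ∈? Z ×-dec v ∈? Z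
    ... | yes (u∈Z , v∈Z) =
      F , ¬CF , to-deleteEdge g (∈-image _) (∣p∩q∣<2⇒¬[x,y∈q] ∣Z∩I∣<2 u∈Z v∈Z (adj⇒≢ G uv)) ,
      q⊆p∪q Z I ∘ ∈-image _
    ... | no ¬[u,v∈Z] = induced-blocks ¬C[Z] (p⊆p∪q I) ¬[u,v∈Z]

module TwoForbidden
  {C : Class} (hered : Hereditary C) {G : Graph} (G-forbidden : Forbidden (EdgeApex C) G)
  {S T : Subset (n G)} (S≢T : S ≢ T)
  (S-forbidden : Forbidden C (G [ S ])) (T-forbidden : Forbidden C (G [ T ]))
  where

  open EdgeApexForbidden hered G-forbidden

  B : Subset (n G)
  B = S ∪ T

  no-common-cover : ∀ {I} → S ∪ I ≡ ⊤ → T ∪ I ≡ ⊤ → ¬ ∣ B ∩ I ∣ < 2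
  no-common-cover {I} S∪I≡⊤ T∪I≡⊤ ∣B∩I∣<2 with ≢⇒∃∈∉ S≢T
  ... | inj₁ (w , w∈S , w∉T) =
    proj₁ T-forbidden (forbidden-⊂ hered {G} S-forbidden (covers⇒⊂ S∪I≡⊤ T∪I≡⊤ ∣B∩I∣<2 w∈S w∉T))
  ... | inj₂ (w , w∈T , w∉S) =
    proj₁ S-forbidden (forbidden-⊂ hered {G} T-forbidden (covers⇒⊂ T∪I≡⊤ S∪I≡⊤ ∣T∪S∩I∣<2 w∈T w∉S))
    where ∣T∪S∩I∣<2 = subst (λ A → ∣ A ∩ I ∣ < 2) (∪-comm S T) ∣B∩I∣<2

  -- If F met B at most once, F would avoid uv and cover V(G) together with S and with T.
  meets-twice : ∀ {u v F} → adj G u v ≡ true → u ∈ B → v ∈ B → ¬ C F →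
                (f : Embedding F (deleteEdge G u v)) → 2 ≤ ∣ B ∩ image (to f) ∣
  meets-twice {u} {v} {F} uv u∈B v∈B ¬CF f with 2 ≤? ∣ B ∩ image (to f) ∣
  ... | yes 2≤∣B∩I∣ = 2≤∣B∩I∣
  ... | no 2≰∣B∩I∣ = ⊥-elim (no-common-cover (covers (p⊆p∪q T) (proj₁ S-forbidden))
                                             (covers (q⊆p∪q S T) (proj₁ T-forbidden)) ∣B∩I∣<2)
    where
    I = image (to f)
    ∣B∩I∣<2 = ≰⇒> 2≰∣B∩I∣
    g : Embedding F G
    g = from-deleteEdge f (∈-image _) (∣p∩q∣<2⇒¬[x,y∈q] ∣B∩I∣<2 u∈B v∈B (adj⇒≢ G uv))
    covers : ∀ {Z} → Z ⊆ B → ¬ C (G [ Z ]) → Z ∪ I ≡ ⊤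
    covers Z⊆B ¬C[Z] = cover ¬C[Z] ¬CF g (≤-<-trans (p⊆q⇒∣p∣≤∣q∣ (∩-monoˡ-⊆ Z⊆B)) ∣B∩I∣<2)

  module Bound {c : ℕ} (forbidden-size : ∀ F → Forbidden C F → n F ≤ c) where

    -- commonEdges G S T is the sum of indicator (common i j) over all pairs i j.
    common : Fin (n G) → Fin (n G) → Bool
    common i j = ⌊ toℕ i <? toℕ j ⌋ ∧ adj G i j ∧ (lookup S i ∧ lookup S j) ∧ (lookup T i ∧ lookup T j)

    indicator : Bool → ℕ
    indicator b = if b then 1 else 0

    common⁻ : ∀ {i j} → common i j ≡ true → adj G i j ≡ true × i ∈ S × j ∈ S
    common⁻ {i} {j} e =
      ij , lookup⇒[]= i S (∧-conicalˡ (lookup S i) _ Sij) , lookup⇒[]= j S (∧-conicalʳ (lookup S i) _ Sij)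
      where
      adj∧S∧T = ∧-conicalʳ ⌊ toℕ i <? toℕ j ⌋ _ e
      ij = ∧-conicalˡ (adj G i j) _ adj∧S∧T
      Sij = ∧-conicalˡ (lookup S i ∧ lookup S j) _ (∧-conicalʳ (adj G i j) _ adj∧S∧T)

    common⁺ : ∀ {i j} → toℕ i < toℕ j → adj G i j ≡ true → i ∈ S → j ∈ S → i ∈ T → j ∈ T → common i j ≡ true
    common⁺ {i} {j} i<j ij i∈S j∈S i∈T j∈T with toℕ i <? toℕ j
    ... | no i≮j = contradiction i<j i≮j
    ... | yes _ rewrite ij | []=⇒lookup i∈S | []=⇒lookup j∈S | []=⇒lookup i∈T | []=⇒lookup j∈T = refl

    common-edge-block : ∀ {i j} → common i j ≡ true →
                        ¬ ¬ (Σ (Subset (n G)) λ Y → AddsAtMost (c ∸ 2) B Y 1 × Blocked Y i j)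
    common-edge-block {i} {j} e = ¬¬-map blocking (forbidden-embedding hered (deleteEdge G i j) ¬C[G-ij])
      where
      ij = proj₁ (common⁻ {i} {j} e)
      i∈B = p⊆p∪q T (proj₁ (proj₂ (common⁻ {i} {j} e)))
      j∈B = p⊆p∪q T (proj₂ (proj₂ (common⁻ {i} {j} e)))
      ¬C[G-ij] : ¬ C (deleteEdge G i j)
      ¬C[G-ij] C[G-ij] = proj₁ G-forbidden (inj₂ (i , j , ij , C[G-ij]))
      blocking : (Σ Graph λ F → Forbidden C F × Embedding F (deleteEdge G i j)) →
                 Σ (Subset (n G)) λ Y → AddsAtMost (c ∸ 2) B Y 1 × Blocked Y i j
      blocking (F , F-forbidden , f) =
        image (to f) ,
        overlap-adds B (image (to f)) (≤-trans (∣image∣≤ (to f)) (forbidden-size F F-forbidden))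
                     (meets-twice ij i∈B j∈B (proj₁ F-forbidden) f) ,
        F , proj₁ F-forbidden , f , ∈-image (to f)

    Block : Fin (n G) → Fin (n G) → Set
    Block i j = Σ (Subset (n G)) λ Y →
                AddsAtMost (c ∸ 2) B Y (indicator (common i j)) × (common i j ≡ true → Blocked Y i j)

    block : ∀ i j → ¬ ¬ Block i j
    block i j with common i j in e
    ... | false = λ ¬block → ¬block (∅ , ∅-adds {d = c ∸ 2} B , λ ())
    ... | true = ¬¬-map (λ (Y , adds , blocked) → Y , adds , λ _ → blocked) (common-edge-block e)

    module _ (blocks : ∀ i j → Block i j) where

      Y : Fin (n G) → Fin (n G) → Subset (n G)
      Y i j = proj₁ (blocks i j)

      Ys : Subset (n G)
      Ys = ⋃ (map (λ i → ⋃ (map (Y i) (allFin _))) (allFin _))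

      ∣B∪Ys∣≤ : ∣ B ∪ Ys ∣ ≤ ∣ B ∣ + commonEdges G S T * (c ∸ 2)
      ∣B∪Ys∣≤ = ⋃-adds (λ i → ⋃-adds (λ j → proj₁ (proj₂ (blocks i j))) (allFin _)) (allFin _) B ⊆-refl

      Y⊆B∪Ys : ∀ i j → Y i j ⊆ B ∪ Ys
      Y⊆B∪Ys i j = q⊆p∪q B Ys ∘ ⊆-⋃ (λ i → ⋃ (map (Y i) (allFin _))) (∈-allFin i) ∘ ⊆-⋃ (Y i) (∈-allFin j)

      common-blocked : ∀ {i j} → common i j ≡ true → Blocked (B ∪ Ys) i j
      common-blocked {i} {j} e = Blocked-⊆ (Y⊆B∪Ys i j) (proj₂ (proj₂ (blocks i j)) e)

      edge-blocked : ∀ {u v} → adj G u v ≡ true → Blocked (B ∪ Ys) u v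
      edge-blocked {u} {v} uv with u ∈? S ×-dec v ∈? S | u ∈? T ×-dec v ∈? T
      ... | no ¬[u,v∈S] | _ = induced-blocks (proj₁ S-forbidden) (p⊆p∪q Ys ∘ p⊆p∪q T) ¬[u,v∈S]
      ... | yes _ | no ¬[u,v∈T] = induced-blocks (proj₁ T-forbidden) (p⊆p∪q Ys ∘ q⊆p∪q S T) ¬[u,v∈T]
      ... | yes (u∈S , v∈S) | yes (u∈T , v∈T) with <-cmp u v
      ...   | tri< u<v _ _ = common-blocked (common⁺ u<v uv u∈S v∈S u∈T v∈T)
      ...   | tri> _ _ v<u = Blocked-comm (common-blocked (common⁺ v<u vu v∈S u∈S v∈T u∈T))
        where vu = trans (Graph.sym G v u) uv
      ...   | tri≈ _ u≡v _ = contradiction u≡v (adj⇒≢ G uv)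

      B∪Ys≡⊤ : B ∪ Ys ≡ ⊤
      B∪Ys≡⊤ = spanning (B ∪ Ys) (proj₁ S-forbidden ∘ hereditary hered (induced-⊆ G S⊆B∪Ys)) edge-blocked
        where
        S⊆B∪Ys : S ⊆ B ∪ Ys
        S⊆B∪Ys = p⊆p∪q Ys ∘ p⊆p∪q T

      bound : n G ≤ c + (c ∸ ∣ S ∩ T ∣) + commonEdges G S T * (c ∸ 2)
      bound = begin
        n G                                   ≡⟨ sym (∣⊤∣≡n (n G)) ⟩
        ∣ ⊤ {n G} ∣                           ≡⟨ cong ∣_∣ (sym B∪Ys≡⊤) ⟩
        ∣ B ∪ Ys ∣                            ≤⟨ ∣B∪Ys∣≤ ⟩
        ∣ B ∣ + commonEdges G S T * (c ∸ 2)   ≤⟨ +-monoˡ-≤ _ ∣B∣≤ ⟩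
        c + (c ∸ ∣ S ∩ T ∣) + commonEdges G S T * (c ∸ 2) ∎
        where
        open ≤-Reasoning
        ∣B∣≤ = ∣p∪q∣≤c+[c∸∣p∩q∣] S T (forbidden-size _ S-forbidden) (forbidden-size _ T-forbidden)

proposition2p3 : (C : Class) → Hereditary C → (c : ℕ) → IsMaxForbiddenSize C c →
    (G : Graph) → Forbidden (EdgeApex C) G →
    (S T : Subset (n G)) → S ≢ T →
    Forbidden C (G [ S ]) → Forbidden C (G [ T ]) →
    n G ≤ c + (c ∸ ∣ S ∩ T ∣) + commonEdges G S T * (c ∸ 2)
proposition2p3 C hered c c-max G G-forbidden S T S≢T S-forbidden T-forbidden =
  decidable-stable (_ ≤? _) (¬¬-map bound (¬¬-∀-Fin λ i → ¬¬-∀-Fin (block i)))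
  where
  open TwoForbidden hered G-forbidden S≢T S-forbidden T-forbidden
  open Bound (proj₁ c-max)
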